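{- For every integer $n > 1$, stit logic does not have the Strong Restricted $n$-Craig Interpolation Property $(SRCIP)_n$; that is, there exist a set of propositional variables $V$ and formulas $A, B \in \mathcal{L}^{\{1,\ldots,n\}}_V$ with $\vdash A \to B$ and $Ag(A)\cap Ag(B) = \emptyset$ such that there is no $C \in \mathcal{L}^{\emptyset}_{|A|\cap|B|}$ (i.e. no formula over the shared variables containing no action modalities $[j]$) with both $\vdash A \to C$ and $\vdash C \to B$.
   Context: For a finite set $Ag$ of agent indices (possibly empty) and a set $V$ of propositional variables, $\mathcal{L}^{Ag}_V$ is the set of stit formulas given by $A ::= p \mid A \to A \mid \bot \mid \Box A \mid [j]A$ with $p \in V$, $j \in Ag$ (other Boolean connectives defined as usual; $\Diamond A := \neg\Box\neg A$); $\mathcal{L}^{\emptyset}_V$ contains no action modalities. $\vdash A$ means derivability in the axiom system $\mathbb{S}$ with axioms: all classical propositional tautologies; S5 axioms for $\Box$ and for each $[j]$; $\Box A \to [j]A$; and $(\Diamond[j_1]A_1 \wedge\dots\wedge \Diamond[j_k]A_k) \to \Diamond([j_1]A_1\wedge\dots\wedge[j_k]A_k)$ for pairwise distinct $j_1,\dots,j_k$; rules: modus ponens and necessitation for $\Box$. (This system is sound and strongly complete for the standard branching-time stit semantics.) For a formula $A$, $|A|$ is the set of propositional variables occurring in $A$ and $Ag(A)$ the set of agent indices occurring in $A$. -}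

module Defs where

open import Data.Nat using (ℕ)
open import Data.Fin using (Fin)
open import Data.Bool using (Bool; true; false; _∧_; not; _∨_)
open import Data.List using (List; []; _∷_; map)
open import Data.List.Relation.Unary.Unique.Propositional using (Unique)
open import Data.Product using (_×_; _,_; proj₁)
open import Relation.Binary.PropositionalEquality using (_≡_)

-- Stit formulas over variables V with agents Fin n (agents {1,…,n});
-- Form V 0 has no action modalities.
data Form (V : Set) (n : ℕ) : Set where
  var  : V → Form V n
  _⇒_  : Form V n → Form V n → Form V n
  ⊥'   : Form V n
  □    : Form V n → Form V n
  [_]  : Fin n → Form V n → Form V n

infixr 5 _⇒_

module _ {V : Set} {n : ℕ} where

  ¬' : Form V n → Form V n
  ¬' A = A ⇒ ⊥'

  ⊤' : Form V n
  ⊤' = ⊥' ⇒ ⊥'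

  _∧'_ : Form V n → Form V n → Form V n
  A ∧' B = ¬' (A ⇒ ¬' B)

  ◇ : Form V n → Form V n
  ◇ A = ¬' (□ (¬' A))

  -- Boolean evaluation: variables and modal formulas are treated as atoms.
  eval : (Form V n → Bool) → Form V n → Bool
  eval v (var p)   = v (var p)
  eval v (A ⇒ B)   = not (eval v A) ∨ eval v B
  eval v ⊥'        = false
  eval v (□ A)     = v (□ A)
  eval v ([ j ] A) = v ([ j ] A)

  Taut : Form V n → Set
  Taut A = (v : Form V n → Bool) → eval v A ≡ true

  conj : Form V n → List (Form V n) → Form V n
  conj A []       = A
  conj A (B ∷ Bs) = A ∧' conj B Bs

  indepAx : (Fin n × Form V n) → List (Fin n × Form V n) → Form V n
  indepAx (j , A) l =
    conj (◇ ([ j ] A)) (map (λ { (i , B) → ◇ ([ i ] B) }) l)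
      ⇒ ◇ (conj ([ j ] A) (map (λ { (i , B) → [ i ] B }) l))

  data ⊢_ : Form V n → Set where
    taut  : ∀ {A} → Taut A → ⊢ A
    K□    : ∀ {A B} → ⊢ (□ (A ⇒ B) ⇒ □ A ⇒ □ B)
    T□    : ∀ {A} → ⊢ (□ A ⇒ A)
    5□    : ∀ {A} → ⊢ (◇ A ⇒ □ (◇ A))
    Kj    : ∀ {j A B} → ⊢ ([ j ] (A ⇒ B) ⇒ [ j ] A ⇒ [ j ] B)
    Tj    : ∀ {j A} → ⊢ ([ j ] A ⇒ A)
    5j    : ∀ {j A} → ⊢ (¬' ([ j ] (¬' A)) ⇒ [ j ] (¬' ([ j ] (¬' A))))
    □j    : ∀ {j A} → ⊢ (□ A ⇒ [ j ] A)
    indep : ∀ (x : Fin n × Form V n) (l : List (Fin n × Form V n)) →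
            Unique (map proj₁ (x ∷ l)) → ⊢ indepAx x l
    mp    : ∀ {A B} → ⊢ (A ⇒ B) → ⊢ A → ⊢ B
    nec   : ∀ {A} → ⊢ A → ⊢ □ A

  infix 2 ⊢_

  data _occursIn_ (p : V) : Form V n → Set where
    here : p occursIn var p
    ⇒ˡ   : ∀ {A B} → p occursIn A → p occursIn (A ⇒ B)
    ⇒ʳ   : ∀ {A B} → p occursIn B → p occursIn (A ⇒ B)
    in□  : ∀ {A} → p occursIn A → p occursIn □ A
    in[] : ∀ {j A} → p occursIn A → p occursIn [ j ] A

  data _agentIn_ (j : Fin n) : Form V n → Set where
    here : ∀ {A} → j agentIn [ j ] A
    ⇒ˡ   : ∀ {A B} → j agentIn A → j agentIn (A ⇒ B)
    ⇒ʳ   : ∀ {A B} → j agentIn B → j agentIn (A ⇒ B)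
    in□  : ∀ {A} → j agentIn A → j agentIn □ A
    in[] : ∀ {i A} → j agentIn A → j agentIn [ i ] A

  data NoAct : Form V n → Set where
    var : ∀ {p} → NoAct (var p)
    imp : ∀ {A B} → NoAct A → NoAct B → NoAct (A ⇒ B)
    bot : NoAct ⊥'
    box : ∀ {A} → NoAct A → NoAct (□ A)

-- Two-history countermodels, one for each distinguished agent d: in M_d the
-- histories are separated by the choice of d and by nobody else's, p holds on
-- one history and q on the other. Then A = ◇[i]p holds in M_i while
-- B = ◇[j]q → ◇(p ∧ q) fails in M_j at the same history, yet a formula without
-- action modalities cannot tell M_i from M_j, so whatever its variables it
-- cannot sit between A and B. On the other hand ⊢ A → B by independence of
-- agents: ◇[i]p ∧ ◇[j]q → ◇([i]p ∧ [j]q) → ◇(p ∧ q).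
module Submission where

open import Defs
open import Data.Bool using (Bool; true; false; T; T?; not; _∨_)
open import Data.Bool.Properties using (T-≡) renaming (_≟_ to _≟ᵇ_)
open import Data.Empty using (⊥; ⊥-elim)
open import Data.Fin using (Fin; zero; suc)
open import Data.Fin.Properties using (_≟_)
open import Data.List using ([]; _∷_; map)
open import Data.List.Relation.Unary.All as All using (All; []; _∷_)
open import Data.List.Relation.Unary.All.Properties using (map⁺; map⁻)
open import Data.List.Relation.Unary.AllPairs using ([]; _∷_)
open import Data.List.Relation.Unary.Unique.Propositional using (Unique)
open import Data.Nat using (ℕ; _<_; suc; s≤s; z≤n)
open import Data.Product using (Σ; _×_; _,_; proj₁; proj₂)
open import Function using (_∘_)
open import Function.Bundles using (_⇔_; mk⇔; Equivalence)
open import Relation.Nullary using (¬_; Dec; yes; no)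
open import Relation.Nullary.Decidable using (_×-dec_; _→-dec_; map′; isYes; toWitness; fromWitness; decidable-stable)
open import Relation.Binary.PropositionalEquality using (_≡_; refl; sym; trans; subst)

open Equivalence using (to; from)

T-⇒ : ∀ a {b} → T (not a ∨ b) ⇔ (T a → T b)
T-⇒ true  = mk⇔ (λ b _ → b) (λ f → f _)
T-⇒ false = mk⇔ (λ _ ()) (λ _ → _)

module _ {V : Set} {n : ℕ} where

  Holds : (Form V n → Bool) → Form V n → Set
  Holds v (var x)   = T (v (var x))
  Holds v (A ⇒ B)   = Holds v A → Holds v B
  Holds v ⊥'        = ⊥
  Holds v (□ A)     = T (v (□ A))
  Holds v ([ j ] A) = T (v ([ j ] A))

  eval⇔Holds : ∀ v A → T (eval v A) ⇔ Holds v A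
  eval⇔Holds v (var x)   = mk⇔ (λ t → t) (λ t → t)
  eval⇔Holds v (A ⇒ B)   = mk⇔
    (λ t a → to (eval⇔Holds v B) (to (T-⇒ (eval v A)) t (from (eval⇔Holds v A) a)))
    (λ h → from (T-⇒ (eval v A)) λ a → from (eval⇔Holds v B) (h (to (eval⇔Holds v A) a)))
  eval⇔Holds v ⊥'        = mk⇔ (λ ()) (λ ())
  eval⇔Holds v (□ A)     = mk⇔ (λ t → t) (λ t → t)
  eval⇔Holds v ([ j ] A) = mk⇔ (λ t → t) (λ t → t)

  tautology : ∀ {A} → (∀ v → Holds v A) → ⊢ A
  tautology {A} h = taut λ v → to T-≡ (from (eval⇔Holds v A) (h v))

  taut-mp : ∀ {A B} → ⊢ A → (∀ v → Holds v A → Holds v B) → ⊢ B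
  taut-mp ⊢A h = mp (tautology h) ⊢A

  taut-mp₂ : ∀ {A B C} → ⊢ A → ⊢ B → (∀ v → Holds v A → Holds v B → Holds v C) → ⊢ C
  taut-mp₂ ⊢A ⊢B h = mp (taut-mp ⊢A h) ⊢B

  contraposition : ∀ {A B} → ⊢ A ⇒ B → ⊢ ¬' B ⇒ ¬' A
  contraposition ⊢A⇒B = taut-mp ⊢A⇒B λ v ab ¬b a → ¬b (ab a)

  ◇-mono : ∀ {A B} → ⊢ A ⇒ B → ⊢ ◇ A ⇒ ◇ B
  ◇-mono ⊢A⇒B = contraposition (mp K□ (nec (contraposition ⊢A⇒B)))

∀-Bool-dec : {P : Bool → Set} → (∀ w → Dec (P w)) → Dec (∀ w → P w)
∀-Bool-dec P? =
  map′ (λ { (t , f) true → t ; (t , f) false → f }) (λ h → h true , h false) (P? true ×-dec P? false)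

-- A single moment whose histories are true and false. Since at most one agent
-- (the distinguished d) has a nontrivial choice, independence of agents holds.
module TwoWorldModel {V : Set} {n : ℕ} (val : V → Bool → Bool) where

  SameCell : Fin n → Fin n → Bool → Bool → Set
  SameCell d j w u = j ≡ d → w ≡ u

  infix 4 _⊨⟨_⟩_
  _⊨⟨_⟩_ : Bool → Fin n → Form V n → Set
  w ⊨⟨ d ⟩ var x   = T (val x w)
  w ⊨⟨ d ⟩ A ⇒ B   = w ⊨⟨ d ⟩ A → w ⊨⟨ d ⟩ B
  w ⊨⟨ d ⟩ ⊥'      = ⊥
  w ⊨⟨ d ⟩ □ A     = ∀ u → u ⊨⟨ d ⟩ A
  w ⊨⟨ d ⟩ [ j ] A = ∀ u → SameCell d j w u → u ⊨⟨ d ⟩ A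

  ⊨-noAct : ∀ {C} → NoAct C → ∀ d d′ {w} → w ⊨⟨ d ⟩ C → w ⊨⟨ d′ ⟩ C
  ⊨-noAct var         d d′ h = h
  ⊨-noAct (imp nA nB) d d′ h = ⊨-noAct nB d d′ ∘ h ∘ ⊨-noAct nA d′ d
  ⊨-noAct (box nA)    d d′ h = λ u → ⊨-noAct nA d d′ (h u)

  module _ (d : Fin n) where

    infix 4 _⊨_
    _⊨_ : Bool → Form V n → Set
    w ⊨ A = w ⊨⟨ d ⟩ A

    ⊨? : ∀ w A → Dec (w ⊨ A)
    ⊨? w (var x)   = T? (val x w)
    ⊨? w (A ⇒ B)   = ⊨? w A →-dec ⊨? w B
    ⊨? w ⊥'        = no λ ()
    ⊨? w (□ A)     = ∀-Bool-dec λ u → ⊨? u A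
    ⊨? w ([ j ] A) = ∀-Bool-dec λ u → ((j ≟ d) →-dec (w ≟ᵇ u)) →-dec ⊨? u A

    eval⇔⊨ : ∀ A w → T (eval (isYes ∘ ⊨? w) A) ⇔ w ⊨ A
    eval⇔⊨ (var x)   w = mk⇔ toWitness fromWitness
    eval⇔⊨ (A ⇒ B)   w = mk⇔
      (λ t a → to (eval⇔⊨ B w) (to (T-⇒ (eval v A)) t (from (eval⇔⊨ A w) a)))
      (λ h → from (T-⇒ (eval v A)) λ a → from (eval⇔⊨ B w) (h (to (eval⇔⊨ A w) a)))
      where v = isYes ∘ ⊨? w
    eval⇔⊨ ⊥'        w = mk⇔ (λ ()) (λ ())
    eval⇔⊨ (□ A)     w = mk⇔ toWitness fromWitness
    eval⇔⊨ ([ j ] A) w = mk⇔ toWitness fromWitness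

    ∧-elimˡ : ∀ {w} A B → w ⊨ A ∧' B → w ⊨ A
    ∧-elimˡ {w} A B h = decidable-stable (⊨? w A) λ ¬a → h λ a _ → ¬a a

    ∧-elimʳ : ∀ {w} A B → w ⊨ A ∧' B → w ⊨ B
    ∧-elimʳ {w} A B h = decidable-stable (⊨? w B) λ ¬b → h λ _ → ¬b

    ◇-elim : ∀ w A → w ⊨ ◇ A → Σ Bool (_⊨ A)
    ◇-elim w A h with ⊨? true A | ⊨? false A
    ... | yes a  | _      = true , a
    ... | no _   | yes a  = false , a
    ... | no ¬at | no ¬af = ⊥-elim (h λ { true → ¬at ; false → ¬af })

    conj-elim : ∀ {w} A As → w ⊨ conj A As → All (w ⊨_) (A ∷ As)
    conj-elim A []       h = h ∷ []
    conj-elim A (B ∷ Bs) h = ∧-elimˡ A (conj B Bs) h ∷ conj-elim B Bs (∧-elimʳ A (conj B Bs) h)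

    conj-intro : ∀ {w} A As → All (w ⊨_) (A ∷ As) → w ⊨ conj A As
    conj-intro A []       (h ∷ [])  = h
    conj-intro A (B ∷ Bs) (h ∷ hs) = λ k → k h (conj-intro B Bs hs)

    act-distinguished : ∀ {w A} → w ⊨ A → w ⊨ [ d ] A
    act-distinguished {A = A} h u w~u = subst (_⊨ A) (w~u refl) h

    act-rigid : ∀ {j w u} A → ¬ j ≡ d → w ⊨ [ j ] A → u ⊨ [ j ] A
    act-rigid A j≢d h t _ = h t (⊥-elim ∘ j≢d)

    Possible : Bool → Fin n × Form V n → Set
    Possible w (j , A) = w ⊨ ◇ ([ j ] A)

    Done : Bool → Fin n × Form V n → Set
    Done w (j , A) = w ⊨ [ j ] A

    possible⇒done : ∀ w x → ¬ proj₁ x ≡ d → Possible w x → ∀ u → Done u x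
    possible⇒done w (j , A) j≢d h u = act-rigid A j≢d (proj₂ (◇-elim w ([ j ] A) h))

    jointly-done : ∀ w l → Unique (map proj₁ l) → All (Possible w) l → Σ Bool λ u → All (Done u) l
    jointly-done w [] _ _ = w , []
    jointly-done w ((j , A) ∷ l) (j∉l ∷ unique) (h ∷ hs) with j ≟ d
    ... | yes refl =
      let u , hu = ◇-elim w ([ j ] A) h
      in  u , hu ∷ All.zipWith (λ {x} (j≢ , h′) → possible⇒done w x (j≢ ∘ sym) h′ u) (map⁻ j∉l , hs)
    ... | no j≢d =
      let u , hus = jointly-done w l unique hs
      in  u , possible⇒done w (j , A) j≢d h u ∷ hus

    Valid : Form V n → Set
    Valid A = ∀ w → w ⊨ A

    indep-valid : ∀ x l → Unique (map proj₁ (x ∷ l)) → Valid (indepAx x l)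
    indep-valid (j , A) l unique w h with conj-elim _ _ h
    ... | hA ∷ hs with jointly-done w ((j , A) ∷ l) unique (hA ∷ map⁻ hs)
    ... | u , dA ∷ ds = λ k → k u (conj-intro _ _ (dA ∷ map⁺ ds))

    sound : ∀ {A} → ⊢ A → Valid A
    sound (taut {A} t) w = to (eval⇔⊨ A w) (from T-≡ (t _))
    sound K□ w h hA u = h u (hA u)
    sound T□ w h = h w
    sound 5□ w h _ = h
    sound Kj w h hA u w~u = h u w~u (hA u w~u)
    sound Tj w h = h w λ _ → refl
    sound 5j w ¬h u w~u hu = ¬h λ t w~t → hu t λ j≡d → trans (sym (w~u j≡d)) (w~t j≡d)
    sound □j w h u _ = h u
    sound (indep x l unique) = indep-valid x l unique
    sound (mp ⊢A⇒B ⊢A) w = sound ⊢A⇒B w (sound ⊢A w)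
    sound (nec ⊢A) w u = sound ⊢A u

module _ {V : Set} {n : ℕ} where

  ∧-noAct : {A B : Form V n} → NoAct A → NoAct B → NoAct (A ∧' B)
  ∧-noAct nA nB = imp (imp nA (imp nB bot)) bot

  ◇-noAct : {A : Form V n} → NoAct A → NoAct (◇ A)
  ◇-noAct nA = imp (box (imp nA bot)) bot

  agentIn-noAct : ∀ {j} {A : Form V n} → NoAct A → ¬ (j agentIn A)
  agentIn-noAct (imp nA _) (⇒ˡ k∈A) = agentIn-noAct nA k∈A
  agentIn-noAct (imp _ nB) (⇒ʳ k∈B) = agentIn-noAct nB k∈B
  agentIn-noAct (box nA)   (in□ k∈A) = agentIn-noAct nA k∈A

  agentIn-◇[] : ∀ {k i} {A : Form V n} → NoAct A → k agentIn ◇ ([ i ] A) → k ≡ i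
  agentIn-◇[] nA (⇒ˡ (in□ (⇒ˡ here)))        = refl
  agentIn-◇[] nA (⇒ˡ (in□ (⇒ˡ (in[] k∈A)))) = ⊥-elim (agentIn-noAct nA k∈A)

data Atom : Set where
  p q : Atom

module _ {n : ℕ} where

  antecedent : Fin n → Form Atom n
  antecedent i = ◇ ([ i ] (var p))

  consequent : Fin n → Form Atom n
  consequent j = ◇ ([ j ] (var q)) ⇒ ◇ (var p ∧' var q)

  antecedent⇒consequent : ∀ {i j} → ¬ i ≡ j → ⊢ antecedent i ⇒ consequent j
  antecedent⇒consequent {i} {j} i≢j =
    taut-mp₂ independent acts-happen λ v ind act a b → act (ind λ k → k a b)
    where
    independent : ⊢ ◇ ([ i ] (var p)) ∧' ◇ ([ j ] (var q)) ⇒ ◇ ([ i ] (var p) ∧' [ j ] (var q))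
    independent = indep (i , var p) ((j , var q) ∷ []) ((i≢j ∷ []) ∷ [] ∷ [])

    acts-happen : ⊢ ◇ ([ i ] (var p) ∧' [ j ] (var q)) ⇒ ◇ (var p ∧' var q)
    acts-happen = ◇-mono (taut-mp₂ (Tj {j = i} {A = var p}) (Tj {j = j} {A = var q})
      λ v tp tq h k → h λ r s → k (tp r) (tq s))

  agents-disjoint : ∀ {i j} → ¬ i ≡ j → ∀ k → k agentIn antecedent i → ¬ (k agentIn consequent j)
  agents-disjoint i≢j k k∈A (⇒ˡ k∈B) = i≢j (trans (sym (agentIn-◇[] var k∈A)) (agentIn-◇[] var k∈B))
  agents-disjoint i≢j k k∈A (⇒ʳ k∈B) = agentIn-noAct (◇-noAct (∧-noAct var var)) k∈B

valuation : Atom → Bool → Bool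
valuation p w = w
valuation q w = not w

no-action-free-interpolant : ∀ {n} (i j : Fin n) →
  ¬ (Σ (Form Atom n) λ C → NoAct C × (⊢ antecedent i ⇒ C) × (⊢ C ⇒ consequent j))
no-action-free-interpolant {n} i j (C , noAct , ⊢A⇒C , ⊢C⇒B) =
  consequent-fails (sound j ⊢C⇒B true (⊨-noAct noAct i j (sound i ⊢A⇒C true antecedent-holds)))
  where
  open TwoWorldModel {n = n} valuation

  antecedent-holds : true ⊨⟨ i ⟩ antecedent i
  antecedent-holds k = k true (act-distinguished i {A = var p} _)

  never-p∧q : ∀ u → ¬ (u ⊨⟨ j ⟩ var p ∧' var q)
  never-p∧q true  h = h λ _ ()
  never-p∧q false h = h λ ()

  consequent-fails : ¬ (true ⊨⟨ j ⟩ consequent j)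
  consequent-fails h = h (λ k → k false (act-distinguished j {A = var q} _)) never-p∧q

theorem4 : (n : ℕ) → 1 < n →
    Σ Set λ V → Σ (Form V n) λ A → Σ (Form V n) λ B →
      (⊢ (A ⇒ B))
      × ((j : Fin n) → j agentIn A → ¬ (j agentIn B))
      × ¬ (Σ (Form V n) λ C →
             NoAct C
             × ((p : V) → p occursIn C → p occursIn A × p occursIn B)
             × (⊢ (A ⇒ C))
             × (⊢ (C ⇒ B)))
theorem4 (suc (suc m)) (s≤s (s≤s z≤n)) =
  Atom , antecedent zero , consequent one ,
  antecedent⇒consequent zero≢one , agents-disjoint zero≢one ,
  λ (C , noAct , _ , ⊢A⇒C , ⊢C⇒B) → no-action-free-interpolant zero one (C , noAct , ⊢A⇒C , ⊢C⇒B)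
  where
  one : Fin (suc (suc m))
  one = suc zero

  zero≢one : ¬ zero ≡ one
  zero≢one ()
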